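{- Let $p$ be a prime and $X_1,\dots,X_6$ points of the projective plane $\mathbb{P}^2(\mathbb{F}_p)$, with $X_1,\dots,X_4$ in general position, and $\ell$ a line containing $X_5$ and $X_6$ but none of $X_1,\dots,X_4$ ($X_5=X_6$ is allowed). Let $Y=X_1X_5\cap X_3X_4$, $X'_5=X_2Y\cap\ell$, $Z=X_2X_6\cap X_3X_4$, $X'_6=X_1Z\cap\ell$, and $B_{1\to2}(X_1,\dots,X_6;\ell)=(X_1,\dots,X_4,X'_5,X'_6;\ell)$. Suppose that: if $X_5\ne X_6$, then $X_1,\dots,X_6$ do not lie on a (possibly degenerate) conic; and if $X_5=X_6$, then $X_1,\dots,X_5$ do not lie on a (possibly degenerate) conic tangent to $\ell$ at $X_5$. Then the same holds for $(X_1,\dots,X_4,X'_5,X'_6;\ell)$: if $X'_5\ne X'_6$ then $X_1,\dots,X_4,X'_5,X'_6$ do not lie on a (possibly degenerate) conic, and if $X'_5=X'_6$ then $X_1,\dots,X_4,X'_5$ do not lie on a (possibly degenerate) conic tangent to $\ell$ at $X'_5$.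
   Context: A degenerate conic is a union of two lines $\mu_1,\mu_2$; such a degenerate conic is said to be tangent to $\ell$ (at the point in question) when $\mu_1,\mu_2,\ell$ are concurrent. $PQ$ denotes the line through distinct points $P,Q$. -}

module Defs where

open import Data.Nat using (ℕ)
open import Data.Integer using (ℤ; +_; _+_; _-_; _*_)
open import Data.Integer.Divisibility using (_∣_)
open import Data.Product using (_×_; Σ; ∃)
open import Relation.Nullary using (¬_)

-- Homogeneous coordinates over 𝔽_p, represented by integer triples;
-- all equalities in 𝔽_p are congruences modulo p.
record V3 : Set where
  constructor v3
  field x y z : ℤ
open V3 public

Zero : ℕ → ℤ → Set
Zero p a = (+ p) ∣ a

ZeroV : ℕ → V3 → Set
ZeroV p v = Zero p (x v) × Zero p (y v) × Zero p (z v)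

-- a point of P²(𝔽_p) / a line of P²(𝔽_p): a nonzero vector (up to scaling)
NonZeroV : ℕ → V3 → Set
NonZeroV p v = ¬ ZeroV p v

cross : V3 → V3 → V3
cross (v3 a b c) (v3 d e f) = v3 (b * f - c * e) (c * d - a * f) (a * e - b * d)

dot : V3 → V3 → ℤ
dot (v3 a b c) (v3 d e f) = a * d + b * e + c * f

SamePt : ℕ → V3 → V3 → Set
SamePt p u v = ZeroV p (cross u v)

-- incidence of point P with line L (coordinates of a line = dual vector)
On : ℕ → V3 → V3 → Set
On p P L = Zero p (dot P L)

join : V3 → V3 → V3
join = cross

meet : V3 → V3 → V3
meet = cross

Collinear : ℕ → V3 → V3 → V3 → Set
Collinear p a b c = Zero p (dot a (cross b c))

GeneralPosition4 : ℕ → V3 → V3 → V3 → V3 → Set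
GeneralPosition4 p a b c d =
  ¬ Collinear p a b c × ¬ Collinear p a b d × ¬ Collinear p a c d × ¬ Collinear p b c d

-- a (possibly degenerate) conic: a nonzero ternary quadratic form
-- a x² + b y² + c z² + d xy + e yz + f zx over 𝔽_p
record Conic : Set where
  constructor conic
  field a b c d e f : ℤ
open Conic public

NonZeroConic : ℕ → Conic → Set
NonZeroConic p q = ¬ (Zero p (a q) × Zero p (b q) × Zero p (c q)
                     × Zero p (d q) × Zero p (e q) × Zero p (f q))

evalQ : Conic → V3 → ℤ
evalQ q (v3 X Y Z) = a q * X * X + b q * Y * Y + c q * Z * Z
                   + d q * X * Y + e q * Y * Z + f q * Z * X

_+V_ : V3 → V3 → V3
v3 a₁ b₁ c₁ +V v3 a₂ b₂ c₂ = v3 (a₁ + a₂) (b₁ + b₂) (c₁ + c₂)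

polar : Conic → V3 → V3 → ℤ
polar q u w = evalQ q (u +V w) - evalQ q u - evalQ q w

OnConic : ℕ → Conic → V3 → Set
OnConic p q P = Zero p (evalQ q P)

-- the conic q is tangent to the line L at the point P (P on q and on L):
-- the restriction of q to L vanishes to order ≥ 2 at P, i.e. B(P,W) = 0
-- for every W on L. For a line pair μ1μ2 this holds iff μ1, μ2, L concur.
TangentAt : ℕ → Conic → V3 → V3 → Set
TangentAt p q L P = OnConic p q P × ((W : V3) → On p W L → Zero p (polar q P W))

OnCommonConic6 : ℕ → V3 → V3 → V3 → V3 → V3 → V3 → Set
OnCommonConic6 p P₁ P₂ P₃ P₄ P₅ P₆ =
  Σ Conic λ q → NonZeroConic p q × OnConic p q P₁ × OnConic p q P₂ × OnConic p q P₃
    × OnConic p q P₄ × OnConic p q P₅ × OnConic p q P₆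

OnTangentConic5 : ℕ → V3 → V3 → V3 → V3 → V3 → V3 → Set
OnTangentConic5 p L P₁ P₂ P₃ P₄ P₅ =
  Σ Conic λ q → NonZeroConic p q × OnConic p q P₁ × OnConic p q P₂ × OnConic p q P₃
    × OnConic p q P₄ × TangentAt p q L P₅

NoConic : ℕ → V3 → V3 → V3 → V3 → V3 → V3 → V3 → Set
NoConic p X₁ X₂ X₃ X₄ X₅ X₆ L =
  (¬ SamePt p X₅ X₆ → ¬ OnCommonConic6 p X₁ X₂ X₃ X₄ X₅ X₆)
  × (SamePt p X₅ X₆ → ¬ OnTangentConic5 p L X₁ X₂ X₃ X₄ X₅)

Y₁₂ : V3 → V3 → V3 → V3 → V3
Y₁₂ X₁ X₃ X₄ X₅ = meet (join X₁ X₅) (join X₃ X₄)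

X₅′ : V3 → V3 → V3 → V3 → V3 → V3 → V3
X₅′ X₁ X₂ X₃ X₄ X₅ L = meet (join X₂ (Y₁₂ X₁ X₃ X₄ X₅)) L

Z₁₂ : V3 → V3 → V3 → V3 → V3
Z₁₂ X₂ X₃ X₄ X₆ = meet (join X₂ X₆) (join X₃ X₄)

X₆′ : V3 → V3 → V3 → V3 → V3 → V3 → V3
X₆′ X₁ X₂ X₃ X₄ X₆ L = meet (join X₁ (Z₁₂ X₂ X₃ X₄ X₆)) L

-- Send X₁, X₂, X₃ to the coordinate points: with t the coordinates of a point relative to X₁X₂X₃,
-- the conics through X₁, X₂, X₃ are β · (t₂t₃, t₃t₁, t₁t₂) = 0.  So X₁, …, X₄, P, Q lie on a conic iff the
-- images of X₄, P, Q under this quadratic map are linearly dependent, and tangency at P is expressed by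
-- its polarisation.  When P, Q lie on ℓ (and X₁, X₂ ∉ ℓ, X₁, …, X₄ in general position) both conditions,
-- the first for P ≠ Q and the second for P = Q, become the vanishing of one bilinear form
--   E(t, u) = l₁s₂s₃t₁u₁ + l₂s₃s₁t₂u₂ + l₃s₁s₂t₃u₃,
-- where s, l, t, u are the coordinates of X₄, ℓ, P, Q.  Modulo the incidences P, Q ∈ ℓ, the map B₁→₂
-- multiplies E by −s₁s₂l₁l₂ ≠ 0, so the non-conic condition is preserved.

module Submission where

open import Defs
open import Data.Nat using (ℕ)
import Data.Nat as ℕ
import Data.Nat.Divisibility as ℕ
open import Data.Nat.Primality using (Prime; euclidsLemma)
open import Data.Integer using (ℤ; +_; 0ℤ; 1ℤ; _+_; _-_; _*_; -_; ∣_∣)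
open import Data.Integer.Properties using (abs-*; neg-involutive)
open import Data.Integer.Divisibility.Signed
  using (_∣_; _∣?_; ∣ᵤ⇒∣; ∣⇒∣ᵤ; ∣m∣n⇒∣m+n; ∣m∣n⇒∣m-n; ∣m⇒∣-m; ∣m+n∣m⇒∣n; ∣m+n∣n⇒∣m; ∣n⇒∣m*n; ∣m⇒∣m*n)
open import Data.Integer.Solver using (module +-*-Solver)
open +-*-Solver
  using (Polynomial; _:+_; _:*_; _:-_; :-_; con; var; ⟦_⟧; ⟦_⟧N; Normal; normalise; prove; solve; _:=_)
open import Data.Fin using (zero; suc; combine)
open import Data.Vec using (Vec; []; _∷_; tabulate)
open import Data.Vec.N-ary using (N-ary; _$ⁿ_)
open import Data.Product using (_×_; _,_; proj₁; proj₂; Σ)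
open import Data.Sum using (_⊎_; inj₁; inj₂)
open import Data.Empty using (⊥-elim)
open import Relation.Nullary using (¬_; Dec; yes; no; _×-dec_)
open import Relation.Nullary.Decidable using (decidable-stable)
open import Relation.Binary.PropositionalEquality
  using (_≡_; refl; sym; trans; cong; cong₂; subst; module ≡-Reasoning)

-- Identities between coordinate expressions are proved by the ring solver: the statement is restated
-- with the ₚ-counterparts of the coordinate operations, each V3 becoming three solver variables; both
-- sides normalise to the same polynomial, and the result is definitionally the original statement.
record V3ₚ (n : ℕ) : Set where
  constructor ⟨_,_,_⟩
  field xₚ yₚ zₚ : Polynomial n
open V3ₚ

coordinates : ∀ {k} → Vec V3 k → Vec ℤ (k ℕ.* 3)
coordinates [] = []
coordinates (v ∷ vs) = x v ∷ y v ∷ z v ∷ coordinates vs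

vectorVariables : ∀ k → Vec (V3ₚ (k ℕ.* 3)) k
vectorVariables k = tabulate λ i →
  ⟨ var (combine i zero) , var (combine i (suc zero)) , var (combine i (suc (suc zero))) ⟩

polynomial-identity : ∀ k (f : N-ary k (V3ₚ (k ℕ.* 3)) (Polynomial (k ℕ.* 3) × Polynomial (k ℕ.* 3))) →
  normalise (proj₁ (f $ⁿ vectorVariables k)) ≡ normalise (proj₂ (f $ⁿ vectorVariables k)) →
  (vs : Vec V3 k) →
  ⟦ proj₁ (f $ⁿ vectorVariables k) ⟧ (coordinates vs) ≡ ⟦ proj₂ (f $ⁿ vectorVariables k) ⟧ (coordinates vs)
polynomial-identity k f same vs = prove ρ lhs rhs (cong (λ nf → ⟦ nf ⟧N ρ) same)
  where
  ρ = coordinates vs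
  lhs = proj₁ (f $ⁿ vectorVariables k)
  rhs = proj₂ (f $ⁿ vectorVariables k)

⟦_⟧V : ∀ {n} → V3ₚ n → Vec ℤ n → V3
⟦ ⟨ a , b , c ⟩ ⟧V ρ = v3 (⟦ a ⟧ ρ) (⟦ b ⟧ ρ) (⟦ c ⟧ ρ)

normaliseV : ∀ {n} → V3ₚ n → Normal n × Normal n × Normal n
normaliseV ⟨ a , b , c ⟩ = normalise a , normalise b , normalise c

v3-cong : ∀ {a a′ b b′ c c′} → a ≡ a′ → b ≡ b′ → c ≡ c′ → v3 a b c ≡ v3 a′ b′ c′
v3-cong refl refl refl = refl

vector-identity : ∀ k (f : N-ary k (V3ₚ (k ℕ.* 3)) (V3ₚ (k ℕ.* 3) × V3ₚ (k ℕ.* 3))) →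
  normaliseV (proj₁ (f $ⁿ vectorVariables k)) ≡ normaliseV (proj₂ (f $ⁿ vectorVariables k)) →
  (vs : Vec V3 k) →
  ⟦ proj₁ (f $ⁿ vectorVariables k) ⟧V (coordinates vs) ≡ ⟦ proj₂ (f $ⁿ vectorVariables k) ⟧V (coordinates vs)
vector-identity k f same vs with proj₁ (f $ⁿ vectorVariables k) | proj₂ (f $ⁿ vectorVariables k)
... | ⟨ a , b , c ⟩ | ⟨ a′ , b′ , c′ ⟩ = v3-cong
  (prove ρ a a′ (cong (λ nf → ⟦ proj₁ nf ⟧N ρ) same))
  (prove ρ b b′ (cong (λ nf → ⟦ proj₁ (proj₂ nf) ⟧N ρ) same))
  (prove ρ c c′ (cong (λ nf → ⟦ proj₂ (proj₂ nf) ⟧N ρ) same))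
  where ρ = coordinates vs

e₁ e₂ e₃ : V3
e₁ = v3 1ℤ 0ℤ 0ℤ
e₂ = v3 0ℤ 1ℤ 0ℤ
e₃ = v3 0ℤ 0ℤ 1ℤ

infixr 7 _*V_ _⊙_

_*V_ : ℤ → V3 → V3
k *V v = v3 (k * x v) (k * y v) (k * z v)

_⊙_ : V3 → V3 → V3
u ⊙ v = v3 (x u * x v) (y u * y v) (z u * z v)

det : V3 → V3 → V3 → ℤ
det a b c = dot a (cross b c)

-- The standard quadratic (Cremona) map; the conics through e₁, e₂, e₃ are β · cremona t = 0.
cremona : V3 → V3
cremona t = v3 (y t * z t) (z t * x t) (x t * y t)

cremonaPolar : V3 → V3 → V3
cremonaPolar t w = v3 (y t * z w + z t * y w) (z t * x w + x t * z w) (x t * y w + y t * x w)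

gradient : V3 → V3 → V3
gradient β t = v3 (y β * z t + z β * y t) (z β * x t + x β * z t) (x β * y t + y β * x t)

-- Coordinates of a point relative to the basis A, B, C, scaled by det A B C, and of a line in the same frame.
frame : V3 → V3 → V3 → V3 → V3
frame A B C P = v3 (det P B C) (det P C A) (det P A B)

dual : V3 → V3 → V3 → V3 → V3
dual A B C L = v3 (dot A L) (dot B L) (dot C L)

combination : V3 → V3 → V3 → V3 → V3
combination A B C w = ((x w *V A) +V (y w *V B)) +V (z w *V C)

polarTriangle : Conic → V3 → V3 → V3 → V3
polarTriangle q A B C = v3 (polar q B C) (polar q C A) (polar q A B)

-- The conic P ↦ β · cremona (frame A B C P), a combination of the products of the side lines.
conicThrough : V3 → V3 → V3 → V3 → Conic
conicThrough A B C β =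
  conic (coeff x x) (coeff y y) (coeff z z) (coeff x y + coeff y x) (coeff y z + coeff z y) (coeff z x + coeff x z)
  where
  coeff : (V3 → ℤ) → (V3 → ℤ) → ℤ
  coeff i j = x β * (i (cross C A) * j (cross A B)) + y β * (i (cross A B) * j (cross B C))
        + z β * (i (cross B C) * j (cross C A))

-- A conic is handed to the solver as the two vectors of its coefficients.
squareCoefficients mixedCoefficients : Conic → V3
squareCoefficients q = v3 (a q) (b q) (c q)
mixedCoefficients q = v3 (d q) (e q) (f q)

-- For t, u on the line l, this vanishes iff e₁, e₂, e₃, s, t, u lie on a conic (tangent to l at t when
-- t = u).
sixPointForm : V3 → V3 → V3 → V3 → ℤ
sixPointForm s l t u = dot u (l ⊙ cremona s ⊙ t)

-- X₅′ and X₆′ in frame coordinates, where X₄ and ℓ have coordinates s and l.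
fifth′ sixth′ : V3 → V3 → V3 → V3
fifth′ s l t = cross (cross e₂ (cross (cross e₁ t) (cross e₃ s))) l
sixth′ s l u = cross (cross e₁ (cross (cross e₂ u) (cross e₃ s))) l

module Polynomials {n : ℕ} where
  infixl 6 _+ₚ_
  infixr 7 _*ₚ_ _⊙ₚ_

  e₁ₚ e₂ₚ e₃ₚ : V3ₚ n
  e₁ₚ = ⟨ con 1ℤ , con 0ℤ , con 0ℤ ⟩
  e₂ₚ = ⟨ con 0ℤ , con 1ℤ , con 0ℤ ⟩
  e₃ₚ = ⟨ con 0ℤ , con 0ℤ , con 1ℤ ⟩

  _+ₚ_ : V3ₚ n → V3ₚ n → V3ₚ n
  ⟨ a , b , c ⟩ +ₚ ⟨ d , e , f ⟩ = ⟨ a :+ d , b :+ e , c :+ f ⟩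

  _⊙ₚ_ : V3ₚ n → V3ₚ n → V3ₚ n
  ⟨ a , b , c ⟩ ⊙ₚ ⟨ d , e , f ⟩ = ⟨ a :* d , b :* e , c :* f ⟩

  dotₚ : V3ₚ n → V3ₚ n → Polynomial n
  dotₚ ⟨ a , b , c ⟩ ⟨ d , e , f ⟩ = a :* d :+ b :* e :+ c :* f

  crossₚ : V3ₚ n → V3ₚ n → V3ₚ n
  crossₚ ⟨ a , b , c ⟩ ⟨ d , e , f ⟩ = ⟨ b :* f :- c :* e , c :* d :- a :* f , a :* e :- b :* d ⟩

  detₚ : V3ₚ n → V3ₚ n → V3ₚ n → Polynomial n
  detₚ a b c = dotₚ a (crossₚ b c)

  cremonaₚ : V3ₚ n → V3ₚ n
  cremonaₚ ⟨ a , b , c ⟩ = ⟨ b :* c , c :* a , a :* b ⟩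

  cremonaPolarₚ : V3ₚ n → V3ₚ n → V3ₚ n
  cremonaPolarₚ ⟨ a , b , c ⟩ ⟨ d , e , f ⟩ = ⟨ b :* f :+ c :* e , c :* d :+ a :* f , a :* e :+ b :* d ⟩

  gradientₚ : V3ₚ n → V3ₚ n → V3ₚ n
  gradientₚ ⟨ a , b , c ⟩ ⟨ d , e , f ⟩ = ⟨ b :* f :+ c :* e , c :* d :+ a :* f , a :* e :+ b :* d ⟩

  evalQₚ : V3ₚ n → V3ₚ n → V3ₚ n → Polynomial n
  evalQₚ ⟨ a , b , c ⟩ ⟨ d , e , f ⟩ ⟨ X , Y , Z ⟩ =
    a :* X :* X :+ b :* Y :* Y :+ c :* Z :* Z :+ d :* X :* Y :+ e :* Y :* Z :+ f :* Z :* X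

  polarₚ : V3ₚ n → V3ₚ n → V3ₚ n → V3ₚ n → Polynomial n
  polarₚ sq mx u w = evalQₚ sq mx (u +ₚ w) :- evalQₚ sq mx u :- evalQₚ sq mx w

  _*ₚ_ : Polynomial n → V3ₚ n → V3ₚ n
  k *ₚ ⟨ a , b , c ⟩ = ⟨ k :* a , k :* b , k :* c ⟩

  frameₚ : V3ₚ n → V3ₚ n → V3ₚ n → V3ₚ n → V3ₚ n
  frameₚ A B C P = ⟨ detₚ P B C , detₚ P C A , detₚ P A B ⟩

  dualₚ : V3ₚ n → V3ₚ n → V3ₚ n → V3ₚ n → V3ₚ n
  dualₚ A B C L = ⟨ dotₚ A L , dotₚ B L , dotₚ C L ⟩

  combinationₚ : V3ₚ n → V3ₚ n → V3ₚ n → V3ₚ n → V3ₚ n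
  combinationₚ A B C w = xₚ w *ₚ A +ₚ yₚ w *ₚ B +ₚ zₚ w *ₚ C

  polarTriangleₚ : V3ₚ n → V3ₚ n → V3ₚ n → V3ₚ n → V3ₚ n → V3ₚ n
  polarTriangleₚ sq mx A B C = ⟨ polarₚ sq mx B C , polarₚ sq mx C A , polarₚ sq mx A B ⟩

  conicThroughₚ : V3ₚ n → V3ₚ n → V3ₚ n → V3ₚ n → V3ₚ n × V3ₚ n
  conicThroughₚ A B C β =
    ⟨ coeff xₚ xₚ , coeff yₚ yₚ , coeff zₚ zₚ ⟩ ,
    ⟨ coeff xₚ yₚ :+ coeff yₚ xₚ , coeff yₚ zₚ :+ coeff zₚ yₚ , coeff zₚ xₚ :+ coeff xₚ zₚ ⟩
    where
    coeff : (V3ₚ n → Polynomial n) → (V3ₚ n → Polynomial n) → Polynomial n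
    coeff i j = xₚ β :* (i (crossₚ C A) :* j (crossₚ A B)) :+ yₚ β :* (i (crossₚ A B) :* j (crossₚ B C))
          :+ zₚ β :* (i (crossₚ B C) :* j (crossₚ C A))

  sixPointFormₚ : V3ₚ n → V3ₚ n → V3ₚ n → V3ₚ n → Polynomial n
  sixPointFormₚ s l t u = dotₚ u (l ⊙ₚ cremonaₚ s ⊙ₚ t)

  fifth′ₚ sixth′ₚ : V3ₚ n → V3ₚ n → V3ₚ n → V3ₚ n
  fifth′ₚ s l t = crossₚ (crossₚ e₂ₚ (crossₚ (crossₚ e₁ₚ t) (crossₚ e₃ₚ s))) l
  sixth′ₚ s l u = crossₚ (crossₚ e₁ₚ (crossₚ (crossₚ e₂ₚ u) (crossₚ e₃ₚ s))) l
open Polynomials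

dot-e₁ : ∀ v → dot e₁ v ≡ x v
dot-e₁ v = polynomial-identity 1 (λ v → dotₚ e₁ₚ v := xₚ v) refl (v ∷ [])

dot-e₂ : ∀ v → dot e₂ v ≡ y v
dot-e₂ v = polynomial-identity 1 (λ v → dotₚ e₂ₚ v := yₚ v) refl (v ∷ [])

dot-e₃ : ∀ v → dot e₃ v ≡ z v
dot-e₃ v = polynomial-identity 1 (λ v → dotₚ e₃ₚ v := zₚ v) refl (v ∷ [])

det-cyclic : ∀ a b c → det a b c ≡ det b c a
det-cyclic a b c = polynomial-identity 3 (λ a b c → detₚ a b c := detₚ b c a) refl (a ∷ b ∷ c ∷ [])

det-swap : ∀ a b c → det a b c ≡ - det b a c
det-swap a b c = polynomial-identity 3 (λ a b c → detₚ a b c := :- detₚ b a c) refl (a ∷ b ∷ c ∷ [])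

cross-orthogonalˡ : ∀ a b → dot (cross a b) a ≡ 0ℤ
cross-orthogonalˡ a b = polynomial-identity 2 (λ a b → dotₚ (crossₚ a b) a := con 0ℤ) refl (a ∷ b ∷ [])

cross-orthogonalʳ : ∀ a b → dot (cross a b) b ≡ 0ℤ
cross-orthogonalʳ a b = polynomial-identity 2 (λ a b → dotₚ (crossₚ a b) b := con 0ℤ) refl (a ∷ b ∷ [])

dot-cross-swap : ∀ a b c → dot (cross a b) c ≡ - dot (cross a c) b
dot-cross-swap a b c =
  polynomial-identity 3 (λ a b c → dotₚ (crossₚ a b) c := :- dotₚ (crossₚ a c) b) refl (a ∷ b ∷ c ∷ [])

dot-cross-det : ∀ a b c → dot (cross a b) c ≡ det a b c
dot-cross-det a b c = polynomial-identity 3 (λ a b c → dotₚ (crossₚ a b) c := detₚ a b c) refl (a ∷ b ∷ c ∷ [])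

dot-cross-cross : ∀ v w a b → dot v (cross w (cross a b)) ≡ dot b w * dot v a - dot a w * dot v b
dot-cross-cross v w a b = polynomial-identity 4
  (λ v w a b → dotₚ v (crossₚ w (crossₚ a b)) := dotₚ b w :* dotₚ v a :- dotₚ a w :* dotₚ v b)
  refl (v ∷ w ∷ a ∷ b ∷ [])

det-cramer : ∀ a b c β w →
  det a b c * dot w β ≡ dot β a * det w b c + dot β b * det w c a + dot β c * det w a b
det-cramer a b c β w = polynomial-identity 5
  (λ a b c β w → detₚ a b c :* dotₚ w β
     := dotₚ β a :* detₚ w b c :+ dotₚ β b :* detₚ w c a :+ dotₚ β c :* detₚ w a b)
  refl (a ∷ b ∷ c ∷ β ∷ w ∷ [])

gradient-polar : ∀ β t w → dot β (cremonaPolar t w) ≡ dot (gradient β t) w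
gradient-polar β t w = polynomial-identity 3
  (λ β t w → dotₚ β (cremonaPolarₚ t w) := dotₚ (gradientₚ β t) w) refl (β ∷ t ∷ w ∷ [])

gradient-euler : ∀ β t → dot (gradient β t) t ≡ dot β (cremona t) + dot β (cremona t)
gradient-euler β t = polynomial-identity 2
  (λ β t → dotₚ (gradientₚ β t) t := dotₚ β (cremonaₚ t) :+ dotₚ β (cremonaₚ t)) refl (β ∷ t ∷ [])

line-gradient-identity : ∀ l g w t v →
  dot w t * dot (cross l g) v
    ≡ dot g t * dot (cross l w) v - dot g (cross l w) * dot v t + dot l t * dot (cross w g) v
line-gradient-identity l g w t v = polynomial-identity 5
  (λ l g w t v → dotₚ w t :* dotₚ (crossₚ l g) v
     := dotₚ g t :* dotₚ (crossₚ l w) v :- dotₚ g (crossₚ l w) :* dotₚ v t :+ dotₚ l t :* dotₚ (crossₚ w g) v)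
  refl (l ∷ g ∷ w ∷ t ∷ v ∷ [])

dot-*V : ∀ a k b → dot a (k *V b) ≡ k * dot a b
dot-*V (v3 a₁ a₂ a₃) k (v3 b₁ b₂ b₃) = +-*-Solver.solve 7
  (λ a₁ a₂ a₃ k b₁ b₂ b₃ → a₁ :* (k :* b₁) :+ a₂ :* (k :* b₂) :+ a₃ :* (k :* b₃)
     := k :* (a₁ :* b₁ :+ a₂ :* b₂ :+ a₃ :* b₃))
  refl a₁ a₂ a₃ k b₁ b₂ b₃

evalQ-e₁ : ∀ q → evalQ q e₁ ≡ a q
evalQ-e₁ q = polynomial-identity 2 (λ sq mx → evalQₚ sq mx e₁ₚ := xₚ sq) refl
  (squareCoefficients q ∷ mixedCoefficients q ∷ [])

evalQ-e₂ : ∀ q → evalQ q e₂ ≡ b q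
evalQ-e₂ q = polynomial-identity 2 (λ sq mx → evalQₚ sq mx e₂ₚ := yₚ sq) refl
  (squareCoefficients q ∷ mixedCoefficients q ∷ [])

evalQ-e₃ : ∀ q → evalQ q e₃ ≡ c q
evalQ-e₃ q = polynomial-identity 2 (λ sq mx → evalQₚ sq mx e₃ₚ := zₚ sq) refl
  (squareCoefficients q ∷ mixedCoefficients q ∷ [])

evalQ-e₁+e₂ : ∀ q → evalQ q (e₁ +V e₂) ≡ a q + b q + d q
evalQ-e₁+e₂ q = polynomial-identity 2 (λ sq mx → evalQₚ sq mx (e₁ₚ +ₚ e₂ₚ) := xₚ sq :+ yₚ sq :+ xₚ mx) refl
  (squareCoefficients q ∷ mixedCoefficients q ∷ [])

evalQ-e₂+e₃ : ∀ q → evalQ q (e₂ +V e₃) ≡ b q + c q + e q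
evalQ-e₂+e₃ q = polynomial-identity 2 (λ sq mx → evalQₚ sq mx (e₂ₚ +ₚ e₃ₚ) := yₚ sq :+ zₚ sq :+ yₚ mx) refl
  (squareCoefficients q ∷ mixedCoefficients q ∷ [])

evalQ-e₃+e₁ : ∀ q → evalQ q (e₃ +V e₁) ≡ c q + a q + f q
evalQ-e₃+e₁ q = polynomial-identity 2 (λ sq mx → evalQₚ sq mx (e₃ₚ +ₚ e₁ₚ) := zₚ sq :+ xₚ sq :+ zₚ mx) refl
  (squareCoefficients q ∷ mixedCoefficients q ∷ [])

frame-incidence : ∀ A B C L P → dot (dual A B C L) (frame A B C P) ≡ det A B C * dot P L
frame-incidence A B C L P = polynomial-identity 5
  (λ A B C L P → dotₚ (dualₚ A B C L) (frameₚ A B C P) := detₚ A B C :* dotₚ P L) refl (A ∷ B ∷ C ∷ L ∷ P ∷ [])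

frame-reconstruction : ∀ A B C P w → det A B C * dot w P ≡ dot (frame A B C P) (dual A B C w)
frame-reconstruction A B C P w = polynomial-identity 5
  (λ A B C P w → detₚ A B C :* dotₚ w P := dotₚ (frameₚ A B C P) (dualₚ A B C w)) refl (A ∷ B ∷ C ∷ P ∷ w ∷ [])

frame-cross : ∀ A B C P Q → cross (frame A B C P) (frame A B C Q) ≡ det A B C *V dual A B C (cross P Q)
frame-cross A B C P Q = vector-identity 5
  (λ A B C P Q → crossₚ (frameₚ A B C P) (frameₚ A B C Q) , detₚ A B C *ₚ dualₚ A B C (crossₚ P Q))
  refl (A ∷ B ∷ C ∷ P ∷ Q ∷ [])

frame-cross-inverse : ∀ A B C P Q w →
  det A B C * det A B C * dot w (cross P Q) ≡ dot (cross (frame A B C P) (frame A B C Q)) (frame A B C w)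
frame-cross-inverse A B C P Q w = polynomial-identity 6
  (λ A B C P Q w → detₚ A B C :* detₚ A B C :* dotₚ w (crossₚ P Q)
     := dotₚ (crossₚ (frameₚ A B C P) (frameₚ A B C Q)) (frameₚ A B C w))
  refl (A ∷ B ∷ C ∷ P ∷ Q ∷ w ∷ [])

frame-join : ∀ A B C L M → frame A B C (cross L M) ≡ cross (dual A B C L) (dual A B C M)
frame-join A B C L M = vector-identity 5
  (λ A B C L M → frameₚ A B C (crossₚ L M) , crossₚ (dualₚ A B C L) (dualₚ A B C M)) refl (A ∷ B ∷ C ∷ L ∷ M ∷ [])

dual-join₁ : ∀ A B C P → dual A B C (cross A P) ≡ cross e₁ (frame A B C P)
dual-join₁ A B C P = vector-identity 4
  (λ A B C P → dualₚ A B C (crossₚ A P) , crossₚ e₁ₚ (frameₚ A B C P)) refl (A ∷ B ∷ C ∷ P ∷ [])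

dual-join₂ : ∀ A B C P → dual A B C (cross B P) ≡ cross e₂ (frame A B C P)
dual-join₂ A B C P = vector-identity 4
  (λ A B C P → dualₚ A B C (crossₚ B P) , crossₚ e₂ₚ (frameₚ A B C P)) refl (A ∷ B ∷ C ∷ P ∷ [])

dual-join₃ : ∀ A B C P → dual A B C (cross C P) ≡ cross e₃ (frame A B C P)
dual-join₃ A B C P = vector-identity 4
  (λ A B C P → dualₚ A B C (crossₚ C P) , crossₚ e₃ₚ (frameₚ A B C P)) refl (A ∷ B ∷ C ∷ P ∷ [])

frame-combination : ∀ A B C w → frame A B C (combination A B C w) ≡ det A B C *V w
frame-combination A B C w = vector-identity 4
  (λ A B C w → frameₚ A B C (combinationₚ A B C w) , detₚ A B C *ₚ w) refl (A ∷ B ∷ C ∷ w ∷ [])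

combination-incidence : ∀ A B C w L → dot (combination A B C w) L ≡ dot w (dual A B C L)
combination-incidence A B C w L = polynomial-identity 5
  (λ A B C w L → dotₚ (combinationₚ A B C w) L := dotₚ w (dualₚ A B C L)) refl (A ∷ B ∷ C ∷ w ∷ L ∷ [])

conic-in-frame : ∀ q A B C P → let t = frame A B C P in
  det A B C * det A B C * evalQ q P
    ≡ x t * x t * evalQ q A + y t * y t * evalQ q B + z t * z t * evalQ q C
      + dot (polarTriangle q A B C) (cremona t)
conic-in-frame q A B C P = polynomial-identity 6
  (λ sq mx A B C P → let t = frameₚ A B C P in
     detₚ A B C :* detₚ A B C :* evalQₚ sq mx P
       := xₚ t :* xₚ t :* evalQₚ sq mx A :+ yₚ t :* yₚ t :* evalQₚ sq mx B :+ zₚ t :* zₚ t :* evalQₚ sq mx C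
          :+ dotₚ (polarTriangleₚ sq mx A B C) (cremonaₚ t))
  refl (squareCoefficients q ∷ mixedCoefficients q ∷ A ∷ B ∷ C ∷ P ∷ [])

polar-in-frame : ∀ q A B C P W → let t = frame A B C P; w = frame A B C W in
  det A B C * det A B C * polar q P W
    ≡ x t * x w * (evalQ q A + evalQ q A) + y t * y w * (evalQ q B + evalQ q B)
      + z t * z w * (evalQ q C + evalQ q C)
      + dot (polarTriangle q A B C) (cremonaPolar t w)
polar-in-frame q A B C P W = polynomial-identity 7
  (λ sq mx A B C P W → let t = frameₚ A B C P; w = frameₚ A B C W in
     detₚ A B C :* detₚ A B C :* polarₚ sq mx P W
       := xₚ t :* xₚ w :* (evalQₚ sq mx A :+ evalQₚ sq mx A) :+ yₚ t :* yₚ w :* (evalQₚ sq mx B :+ evalQₚ sq mx B)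
          :+ zₚ t :* zₚ w :* (evalQₚ sq mx C :+ evalQₚ sq mx C)
          :+ dotₚ (polarTriangleₚ sq mx A B C) (cremonaPolarₚ t w))
  refl (squareCoefficients q ∷ mixedCoefficients q ∷ A ∷ B ∷ C ∷ P ∷ W ∷ [])

conicThrough-eval : ∀ A B C β P → evalQ (conicThrough A B C β) P ≡ dot β (cremona (frame A B C P))
conicThrough-eval A B C β P = polynomial-identity 5
  (λ A B C β P → evalQₚ (proj₁ (conicThroughₚ A B C β)) (proj₂ (conicThroughₚ A B C β)) P
     := dotₚ β (cremonaₚ (frameₚ A B C P)))
  refl (A ∷ B ∷ C ∷ β ∷ P ∷ [])

conicThrough-polar : ∀ A B C β P W →
  polar (conicThrough A B C β) P W ≡ dot β (cremonaPolar (frame A B C P) (frame A B C W))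
conicThrough-polar A B C β P W = polynomial-identity 6
  (λ A B C β P W → polarₚ (proj₁ (conicThroughₚ A B C β)) (proj₂ (conicThroughₚ A B C β)) P W
     := dotₚ β (cremonaPolarₚ (frameₚ A B C P) (frameₚ A B C W)))
  refl (A ∷ B ∷ C ∷ β ∷ P ∷ W ∷ [])

cremona-frame-vertex₁ : ∀ A B C β → dot β (cremona (frame A B C A)) ≡ 0ℤ
cremona-frame-vertex₁ A B C β = polynomial-identity 4
  (λ A B C β → dotₚ β (cremonaₚ (frameₚ A B C A)) := con 0ℤ) refl (A ∷ B ∷ C ∷ β ∷ [])

cremona-frame-vertex₂ : ∀ A B C β → dot β (cremona (frame A B C B)) ≡ 0ℤ
cremona-frame-vertex₂ A B C β = polynomial-identity 4
  (λ A B C β → dotₚ β (cremonaₚ (frameₚ A B C B)) := con 0ℤ) refl (A ∷ B ∷ C ∷ β ∷ [])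

cremona-frame-vertex₃ : ∀ A B C β → dot β (cremona (frame A B C C)) ≡ 0ℤ
cremona-frame-vertex₃ A B C β = polynomial-identity 4
  (λ A B C β → dotₚ β (cremonaₚ (frameₚ A B C C)) := con 0ℤ) refl (A ∷ B ∷ C ∷ β ∷ [])

cremona-frame-edge₁ : ∀ A B C β → dot β (cremona (frame A B C (B +V C))) ≡ det A B C * det A B C * x β
cremona-frame-edge₁ A B C β = polynomial-identity 4
  (λ A B C β → dotₚ β (cremonaₚ (frameₚ A B C (B +ₚ C))) := detₚ A B C :* detₚ A B C :* xₚ β)
  refl (A ∷ B ∷ C ∷ β ∷ [])

cremona-frame-edge₂ : ∀ A B C β → dot β (cremona (frame A B C (C +V A))) ≡ det A B C * det A B C * y β
cremona-frame-edge₂ A B C β = polynomial-identity 4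
  (λ A B C β → dotₚ β (cremonaₚ (frameₚ A B C (C +ₚ A))) := detₚ A B C :* detₚ A B C :* yₚ β)
  refl (A ∷ B ∷ C ∷ β ∷ [])

cremona-frame-edge₃ : ∀ A B C β → dot β (cremona (frame A B C (A +V B))) ≡ det A B C * det A B C * z β
cremona-frame-edge₃ A B C β = polynomial-identity 4
  (λ A B C β → dotₚ β (cremonaₚ (frameₚ A B C (A +ₚ B))) := detₚ A B C :* detₚ A B C :* zₚ β)
  refl (A ∷ B ∷ C ∷ β ∷ [])

cremona-det-via-sixPointForm : ∀ s l t u w →
  dot w l * det (cremona s) (cremona t) (cremona u) + dot w (cross t u) * sixPointForm s l t u
    ≡ dot l u * dot w (s ⊙ cremona t ⊙ cross s u) - dot l t * dot w (s ⊙ cremona u ⊙ cross s t)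
cremona-det-via-sixPointForm s l t u w = polynomial-identity 5
  (λ s l t u w →
     dotₚ w l :* detₚ (cremonaₚ s) (cremonaₚ t) (cremonaₚ u) :+ dotₚ w (crossₚ t u) :* sixPointFormₚ s l t u
     := dotₚ l u :* dotₚ w (s ⊙ₚ cremonaₚ t ⊙ₚ crossₚ s u) :- dotₚ l t :* dotₚ w (s ⊙ₚ cremonaₚ u ⊙ₚ crossₚ s t))
  refl (s ∷ l ∷ t ∷ u ∷ w ∷ [])

cremonaPolar-det-via-sixPointForm : ∀ s l t w →
  det (cremona s) (cremona t) (cremonaPolar t (cross l w)) + dot w t * sixPointForm s l t t
    ≡ dot l t * dot w (cremona s ⊙ t ⊙ t)
cremonaPolar-det-via-sixPointForm s l t w = polynomial-identity 4
  (λ s l t w → detₚ (cremonaₚ s) (cremonaₚ t) (cremonaPolarₚ t (crossₚ l w)) :+ dotₚ w t :* sixPointFormₚ s l t t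
     := dotₚ l t :* dotₚ w (cremonaₚ s ⊙ₚ t ⊙ₚ t))
  refl (s ∷ l ∷ t ∷ w ∷ [])

sixPointForm-fifth′-sixth′ : ∀ s l t u →
  sixPointForm s l (fifth′ s l t) (sixth′ s l u) + x s * y s * x l * y l * sixPointForm s l t u
    ≡ x l * y l * x s * y s * z s * (y s * x u * dot l t + x s * y t * dot l u)
sixPointForm-fifth′-sixth′ s l t u = polynomial-identity 4
  (λ s l t u →
     sixPointFormₚ s l (fifth′ₚ s l t) (sixth′ₚ s l u) :+ xₚ s :* yₚ s :* xₚ l :* yₚ l :* sixPointFormₚ s l t u
     := xₚ l :* yₚ l :* xₚ s :* yₚ s :* zₚ s :* (yₚ s :* xₚ u :* dotₚ l t :+ xₚ s :* yₚ t :* dotₚ l u))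
  refl (s ∷ l ∷ t ∷ u ∷ [])

fifth′-x : ∀ s l t → x (fifth′ s l t) ≡ - (y l * x s * y t)
fifth′-x s l t =
  polynomial-identity 3 (λ s l t → xₚ (fifth′ₚ s l t) := :- (yₚ l :* xₚ s :* yₚ t)) refl (s ∷ l ∷ t ∷ [])

fifth′-z : ∀ s l t → z (fifth′ s l t) ≡ - (y l * y s * z t)
fifth′-z s l t =
  polynomial-identity 3 (λ s l t → zₚ (fifth′ₚ s l t) := :- (yₚ l :* yₚ s :* zₚ t)) refl (s ∷ l ∷ t ∷ [])

module Modulo (p : ℕ) (p-prime : Prime p) where

  -- Zero p through the signed divisibility record, whose type determines the divided integer.
  Null : ℤ → Set
  Null a = + p ∣ a

  NullV : V3 → Set
  NullV v = Null (x v) × Null (y v) × Null (z v)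

  zero⇒null : ∀ {a} → Zero p a → Null a
  zero⇒null = ∣ᵤ⇒∣

  null⇒zero : ∀ {a} → Null a → Zero p a
  null⇒zero = ∣⇒∣ᵤ

  zeroV⇒nullV : ∀ {v} → ZeroV p v → NullV v
  zeroV⇒nullV (n₁ , n₂ , n₃) = zero⇒null n₁ , zero⇒null n₂ , zero⇒null n₃

  nullV⇒zeroV : ∀ {v} → NullV v → ZeroV p v
  nullV⇒zeroV (n₁ , n₂ , n₃) = null⇒zero n₁ , null⇒zero n₂ , null⇒zero n₃

  null-0 : Null 0ℤ
  null-0 = zero⇒null (ℕ.divides 0 refl)

  null-≡ : ∀ {a b} → a ≡ b → Null b → Null a
  null-≡ refl n = n

  null-neg : ∀ {a} → Null (- a) → Null a
  null-neg {a} n = null-≡ (sym (neg-involutive a)) (∣m⇒∣-m n)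

  null-+-cancelˡ : ∀ {a b} → Null (a + b) → Null a → Null b
  null-+-cancelˡ = ∣m+n∣m⇒∣n

  null-+-cancelʳ : ∀ {a b} → Null (a + b) → Null b → Null a
  null-+-cancelʳ = ∣m+n∣n⇒∣m

  null-−-cancelˡ : ∀ {a b} → Null (a - b) → Null a → Null b
  null-−-cancelˡ h na = null-neg (∣m+n∣m⇒∣n h na)

  null-−-cancelʳ : ∀ {a b} → Null (a - b) → Null b → Null a
  null-−-cancelʳ h nb = ∣m+n∣n⇒∣m h (∣m⇒∣-m nb)

  null-*-split : ∀ {a b} → Null (a * b) → Null a ⊎ Null b
  null-*-split {a} {b} n with euclidsLemma ∣ a ∣ ∣ b ∣ p-prime (subst (p ℕ.∣_) (abs-* a b) (null⇒zero n))
  ... | inj₁ na = inj₁ (zero⇒null na)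
  ... | inj₂ nb = inj₂ (zero⇒null nb)

  null-*-cancelˡ : ∀ {a b} → ¬ Null a → Null (a * b) → Null b
  null-*-cancelˡ a≢0 n with null-*-split n
  ... | inj₁ a≡0 = ⊥-elim (a≢0 a≡0)
  ... | inj₂ b≡0 = b≡0

  null-*-cancelʳ : ∀ {a b} → ¬ Null b → Null (a * b) → Null a
  null-*-cancelʳ b≢0 n with null-*-split n
  ... | inj₁ a≡0 = a≡0
  ... | inj₂ b≡0 = ⊥-elim (b≢0 b≡0)

  ¬null-* : ∀ {a b} → ¬ Null a → ¬ Null b → ¬ Null (a * b)
  ¬null-* a≢0 b≢0 n = b≢0 (null-*-cancelˡ a≢0 n)

  null-dot : ∀ {v} w → NullV v → Null (dot w v)
  null-dot w (n₁ , n₂ , n₃) = ∣m∣n⇒∣m+n (∣m∣n⇒∣m+n (∣n⇒∣m*n (x w) n₁) (∣n⇒∣m*n (y w) n₂)) (∣n⇒∣m*n (z w) n₃)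

  null-dotˡ : ∀ {w} v → NullV w → Null (dot w v)
  null-dotˡ v (n₁ , n₂ , n₃) = ∣m∣n⇒∣m+n (∣m∣n⇒∣m+n (∣m⇒∣m*n (x v) n₁) (∣m⇒∣m*n (y v) n₂)) (∣m⇒∣m*n (z v) n₃)

  null-*V : ∀ {v} k → NullV v → NullV (k *V v)
  null-*V k (n₁ , n₂ , n₃) = ∣n⇒∣m*n k n₁ , ∣n⇒∣m*n k n₂ , ∣n⇒∣m*n k n₃

  null-det₃ : ∀ a b {c} → NullV c → Null (det a b c)
  null-det₃ a b {c} c≡0 = null-≡ (trans (det-cyclic a b c) (det-cyclic b c a)) (null-dotˡ (cross a b) c≡0)

  nullV-from-basis : ∀ {v} → Null (dot e₁ v) → Null (dot e₂ v) → Null (dot e₃ v) → NullV v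
  nullV-from-basis {v} n₁ n₂ n₃ =
    null-≡ (sym (dot-e₁ v)) n₁ , null-≡ (sym (dot-e₂ v)) n₂ , null-≡ (sym (dot-e₃ v)) n₃

  nullV-from-dots : ∀ {v} → (∀ w → Null (dot w v)) → NullV v
  nullV-from-dots n = nullV-from-basis (n e₁) (n e₂) (n e₃)

  nullV? : ∀ v → Dec (NullV v)
  nullV? v = (+ p ∣? x v) ×-dec (+ p ∣? y v) ×-dec (+ p ∣? z v)

  nonzero-coordinate : ∀ {v} → ¬ NullV v → Σ V3 λ w → ¬ Null (dot w v)
  nonzero-coordinate {v} v≢0 with + p ∣? dot e₁ v | + p ∣? dot e₂ v | + p ∣? dot e₃ v
  ... | no n₁ | _ | _ = e₁ , n₁
  ... | yes _ | no n₂ | _ = e₂ , n₂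
  ... | yes _ | yes _ | no n₃ = e₃ , n₃
  ... | yes n₁ | yes n₂ | yes n₃ = ⊥-elim (v≢0 (nullV-from-basis n₁ n₂ n₃))

  nonzero-cross : ∀ {a} → ¬ NullV a → Σ V3 λ w → ¬ NullV (cross a w)
  nonzero-cross {a} a≢0 with + p ∣? x a | + p ∣? y a | + p ∣? z a
  ... | no n₁ | _ | _ = e₂ , λ (_ , _ , n) → n₁ (null-≡ (sym cross-e₂) n)
    where
    cross-e₂ : z (cross a e₂) ≡ x a
    cross-e₂ = polynomial-identity 1 (λ a → zₚ (crossₚ a e₂ₚ) := xₚ a) refl (a ∷ [])
  ... | yes _ | no n₂ | _ = e₃ , λ (n , _ , _) → n₂ (null-≡ (sym cross-e₃) n)
    where
    cross-e₃ : x (cross a e₃) ≡ y a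
    cross-e₃ = polynomial-identity 1 (λ a → xₚ (crossₚ a e₃ₚ) := yₚ a) refl (a ∷ [])
  ... | yes _ | yes _ | no n₃ = e₁ , λ (_ , n , _) → n₃ (null-≡ (sym cross-e₁) n)
    where
    cross-e₁ : y (cross a e₁) ≡ z a
    cross-e₁ = polynomial-identity 1 (λ a → yₚ (crossₚ a e₁ₚ) := zₚ a) refl (a ∷ [])
  ... | yes n₁ | yes n₂ | yes n₃ = ⊥-elim (a≢0 (n₁ , n₂ , n₃))

  null-det-of-normal : ∀ {a b c β} → ¬ NullV β →
    Null (dot β a) → Null (dot β b) → Null (dot β c) → Null (det a b c)
  null-det-of-normal {a} {b} {c} {β} β≢0 na nb nc with nonzero-coordinate β≢0
  ... | w , w·β≢0 = null-*-cancelʳ w·β≢0 (null-≡ (det-cramer a b c β w)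
      (∣m∣n⇒∣m+n (∣m∣n⇒∣m+n (∣m⇒∣m*n _ na) (∣m⇒∣m*n _ nb)) (∣m⇒∣m*n _ nc)))

  CommonNormal : V3 → V3 → V3 → Set
  CommonNormal a b c = Σ V3 λ β → ¬ NullV β × Null (dot β a) × Null (dot β b) × Null (dot β c)

  common-normal : ∀ {a b c} → ¬ NullV a → Null (det a b c) → CommonNormal a b c
  common-normal {a} {b} {c} a≢0 abc≡0 with nullV? (cross a b) | nullV? (cross a c)
  ... | no ab≢0 | _ = cross a b , ab≢0 , null-≡ (cross-orthogonalˡ a b) null-0 ,
      null-≡ (cross-orthogonalʳ a b) null-0 , null-≡ (dot-cross-det a b c) abc≡0
  ... | yes _ | no ac≢0 = cross a c , ac≢0 , null-≡ (cross-orthogonalˡ a c) null-0 ,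
      null-≡ (trans (dot-cross-swap a c b) (cong -_ (dot-cross-det a b c))) (∣m⇒∣-m abc≡0) ,
      null-≡ (cross-orthogonalʳ a c) null-0
  ... | yes ab≡0 | yes ac≡0 with nonzero-cross a≢0
  ...   | w , aw≢0 = cross a w , aw≢0 , null-≡ (cross-orthogonalˡ a w) null-0 ,
      null-≡ (dot-cross-swap a w b) (∣m⇒∣-m (null-dotˡ w ab≡0)) ,
      null-≡ (dot-cross-swap a w c) (∣m⇒∣-m (null-dotˡ w ac≡0))

  vanishing-conic-is-zero : ∀ q → NonZeroConic p q → ¬ (∀ P → Null (evalQ q P))
  vanishing-conic-is-zero q q≢0 vanishes = q≢0
    (null⇒zero a≡0 , null⇒zero b≡0 , null⇒zero c≡0 , null⇒zero d≡0 , null⇒zero e≡0 , null⇒zero f≡0)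
    where
    a≡0 = null-≡ (sym (evalQ-e₁ q)) (vanishes e₁)
    b≡0 = null-≡ (sym (evalQ-e₂ q)) (vanishes e₂)
    c≡0 = null-≡ (sym (evalQ-e₃ q)) (vanishes e₃)
    d≡0 = null-+-cancelˡ (null-≡ (sym (evalQ-e₁+e₂ q)) (vanishes (e₁ +V e₂))) (∣m∣n⇒∣m+n a≡0 b≡0)
    e≡0 = null-+-cancelˡ (null-≡ (sym (evalQ-e₂+e₃ q)) (vanishes (e₂ +V e₃))) (∣m∣n⇒∣m+n b≡0 c≡0)
    f≡0 = null-+-cancelˡ (null-≡ (sym (evalQ-e₃+e₁ q)) (vanishes (e₃ +V e₁))) (∣m∣n⇒∣m+n c≡0 a≡0)

  nonvanishing-conic-is-nonzero : ∀ q P → ¬ Null (evalQ q P) → NonZeroConic p q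
  nonvanishing-conic-is-nonzero q (v3 X Y Z) qP≢0 (a≡0 , b≡0 , c≡0 , d≡0 , e≡0 , f≡0) = qP≢0
    (∣m∣n⇒∣m+n (∣m∣n⇒∣m+n (∣m∣n⇒∣m+n (∣m∣n⇒∣m+n (∣m∣n⇒∣m+n
      (monomial (a q) X X a≡0) (monomial (b q) Y Y b≡0)) (monomial (c q) Z Z c≡0))
      (monomial (d q) X Y d≡0)) (monomial (e q) Y Z e≡0)) (monomial (f q) Z X f≡0))
    where
    monomial : ∀ k u w → Zero p k → Null (k * u * w)
    monomial k u w k≡0 = ∣m⇒∣m*n w (∣m⇒∣m*n u (zero⇒null {k} k≡0))

  sixPointForm-swap : ∀ s l t u w → NullV (cross t u) →
    Null (sixPointForm s l t u * dot w t - sixPointForm s l t t * dot w u)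
  sixPointForm-swap s l t u w tu≡0 =
    null-≡ (sym (dot-cross-cross w (l ⊙ cremona s ⊙ t) t u)) (null-det₃ w (l ⊙ cremona s ⊙ t) tu≡0)

  -- The gradient is proportional to l by line-gradient-identity, hence vanishes on l.
  gradient-along-line : ∀ β t l w → ¬ NullV l → ¬ Null (dot w t) →
    Null (dot β (cremona t)) → Null (dot β (cremonaPolar t (cross l w))) → Null (dot l t) →
    ∀ {W} → Null (dot l W) → Null (dot (gradient β t) W)
  gradient-along-line β t l w l≢0 w·t≢0 βt βtw lt {W} lW = null-*-cancelʳ v·l≢0
    (null-−-cancelʳ (null-≡ (sym (dot-cross-cross v W l g)) vWlg) (∣m⇒∣m*n (dot v g) lW))
    where
    g = gradient β t
    v = proj₁ (nonzero-coordinate l≢0)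
    v·l≢0 = proj₂ (nonzero-coordinate l≢0)
    gt : Null (dot g t)
    gt = null-≡ (gradient-euler β t) (∣m∣n⇒∣m+n βt βt)
    glw : Null (dot g (cross l w))
    glw = null-≡ (sym (gradient-polar β t (cross l w))) βtw
    lg : ∀ u → Null (dot (cross l g) u)
    lg u = null-*-cancelˡ w·t≢0 (null-≡ (line-gradient-identity l g w t u)
      (∣m∣n⇒∣m+n (∣m∣n⇒∣m-n (∣m⇒∣m*n _ gt) (∣m⇒∣m*n _ glw)) (∣m⇒∣m*n _ lt)))
    vWlg : Null (det v W (cross l g))
    vWlg = null-≡ (trans (det-cyclic v W (cross l g)) (det-cyclic W (cross l g) v)) (lg (cross v W))

  module Frame (X₁ X₂ X₃ : V3) (Δ≢0 : ¬ Null (det X₁ X₂ X₃)) where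

    Δ : ℤ
    Δ = det X₁ X₂ X₃

    point line : V3 → V3
    point = frame X₁ X₂ X₃
    line = dual X₁ X₂ X₃

    Δ²≢0 : ¬ Null (Δ * Δ)
    Δ²≢0 = ¬null-* Δ≢0 Δ≢0

    incident : ∀ P L → On p P L → Null (dot (line L) (point P))
    incident P L P∈L = null-≡ (frame-incidence X₁ X₂ X₃ L P) (∣n⇒∣m*n Δ (zero⇒null P∈L))

    point-nonzero : ∀ P → NonZeroV p P → ¬ NullV (point P)
    point-nonzero P P≢0 t≡0 = P≢0 (nullV⇒zeroV (nullV-from-dots λ w →
      null-*-cancelˡ Δ≢0 (null-≡ (frame-reconstruction X₁ X₂ X₃ P w) (null-dotˡ (line w) t≡0))))

    same⇒parallel : ∀ P Q → SamePt p P Q → NullV (cross (point P) (point Q))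
    same⇒parallel P Q P≡Q = subst NullV (sym (frame-cross X₁ X₂ X₃ P Q)) (null-*V Δ
      (null-dot X₁ PQ≡0 , null-dot X₂ PQ≡0 , null-dot X₃ PQ≡0))
      where PQ≡0 = zeroV⇒nullV P≡Q

    parallel⇒same : ∀ P Q → NullV (cross (point P) (point Q)) → SamePt p P Q
    parallel⇒same P Q tu≡0 = nullV⇒zeroV (nullV-from-dots λ w →
      null-*-cancelˡ Δ²≢0 (null-≡ (frame-cross-inverse X₁ X₂ X₃ P Q w) (null-dotˡ (point w) tu≡0)))

    module ThroughVertices (q : Conic) (o₁ : OnConic p q X₁) (o₂ : OnConic p q X₂) (o₃ : OnConic p q X₃) where

      β : V3
      β = polarTriangle q X₁ X₂ X₃

      vertex-terms : ∀ t → Null (x t * x t * evalQ q X₁ + y t * y t * evalQ q X₂ + z t * z t * evalQ q X₃)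
      vertex-terms t = ∣m∣n⇒∣m+n (∣m∣n⇒∣m+n (∣n⇒∣m*n (x t * x t) (zero⇒null {evalQ q X₁} o₁))
        (∣n⇒∣m*n (y t * y t) (zero⇒null {evalQ q X₂} o₂))) (∣n⇒∣m*n (z t * z t) (zero⇒null {evalQ q X₃} o₃))

      polar-vertex-terms : ∀ t w → Null (x t * x w * (evalQ q X₁ + evalQ q X₁)
        + y t * y w * (evalQ q X₂ + evalQ q X₂) + z t * z w * (evalQ q X₃ + evalQ q X₃))
      polar-vertex-terms t w = ∣m∣n⇒∣m+n (∣m∣n⇒∣m+n (∣n⇒∣m*n (x t * x w) (double {X₁} o₁))
        (∣n⇒∣m*n (y t * y w) (double {X₂} o₂))) (∣n⇒∣m*n (z t * z w) (double {X₃} o₃))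
        where
        double : ∀ {X} → OnConic p q X → Null (evalQ q X + evalQ q X)
        double {X} o = ∣m∣n⇒∣m+n (zero⇒null {evalQ q X} o) (zero⇒null {evalQ q X} o)

      on⇒null : ∀ {P} → OnConic p q P → Null (dot β (cremona (point P)))
      on⇒null {P} o = null-+-cancelˡ
        (null-≡ (sym (conic-in-frame q X₁ X₂ X₃ P)) (∣n⇒∣m*n (Δ * Δ) (zero⇒null {evalQ q P} o)))
        (vertex-terms (point P))

      polar⇒null : ∀ {P W} → Null (polar q P W) → Null (dot β (cremonaPolar (point P) (point W)))
      polar⇒null {P} {W} h = null-+-cancelˡ (null-≡ (sym (polar-in-frame q X₁ X₂ X₃ P W)) (∣n⇒∣m*n (Δ * Δ) h))
        (polar-vertex-terms (point P) (point W))

      β-nonzero : NonZeroConic p q → ¬ NullV β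
      β-nonzero q≢0 β≡0 = vanishing-conic-is-zero q q≢0 λ P → null-*-cancelˡ Δ²≢0
        (null-≡ (conic-in-frame q X₁ X₂ X₃ P)
          (∣m∣n⇒∣m+n (vertex-terms (point P)) (null-dotˡ (cremona (point P)) β≡0)))

    conicThrough-on : ∀ β P → Null (dot β (cremona (point P))) → OnConic p (conicThrough X₁ X₂ X₃ β) P
    conicThrough-on β P h = null⇒zero (null-≡ (conicThrough-eval X₁ X₂ X₃ β P) h)

    conicThrough-vertex₁ : ∀ β → OnConic p (conicThrough X₁ X₂ X₃ β) X₁
    conicThrough-vertex₁ β = conicThrough-on β X₁ (null-≡ (cremona-frame-vertex₁ X₁ X₂ X₃ β) null-0)

    conicThrough-vertex₂ : ∀ β → OnConic p (conicThrough X₁ X₂ X₃ β) X₂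
    conicThrough-vertex₂ β = conicThrough-on β X₂ (null-≡ (cremona-frame-vertex₂ X₁ X₂ X₃ β) null-0)

    conicThrough-vertex₃ : ∀ β → OnConic p (conicThrough X₁ X₂ X₃ β) X₃
    conicThrough-vertex₃ β = conicThrough-on β X₃ (null-≡ (cremona-frame-vertex₃ X₁ X₂ X₃ β) null-0)

    conicThrough-nonzero : ∀ β → ¬ NullV β → NonZeroConic p (conicThrough X₁ X₂ X₃ β)
    conicThrough-nonzero β β≢0 with + p ∣? x β | + p ∣? y β | + p ∣? z β
    ... | no n₁ | _ | _ = nonvanishing-conic-is-nonzero (conicThrough X₁ X₂ X₃ β) (X₂ +V X₃)
      λ h → n₁ (null-*-cancelˡ Δ²≢0 (null-≡ (sym (trans (conicThrough-eval X₁ X₂ X₃ β (X₂ +V X₃))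
                                                        (cremona-frame-edge₁ X₁ X₂ X₃ β))) h))
    ... | yes _ | no n₂ | _ = nonvanishing-conic-is-nonzero (conicThrough X₁ X₂ X₃ β) (X₃ +V X₁)
      λ h → n₂ (null-*-cancelˡ Δ²≢0 (null-≡ (sym (trans (conicThrough-eval X₁ X₂ X₃ β (X₃ +V X₁))
                                                        (cremona-frame-edge₂ X₁ X₂ X₃ β))) h))
    ... | yes _ | yes _ | no n₃ = nonvanishing-conic-is-nonzero (conicThrough X₁ X₂ X₃ β) (X₁ +V X₂)
      λ h → n₃ (null-*-cancelˡ Δ²≢0 (null-≡ (sym (trans (conicThrough-eval X₁ X₂ X₃ β (X₁ +V X₂))
                                                        (cremona-frame-edge₃ X₁ X₂ X₃ β))) h))
    ... | yes n₁ | yes n₂ | yes n₃ = ⊥-elim (β≢0 (n₁ , n₂ , n₃))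

module Configuration (p : ℕ) (p-prime : Prime p) (X₁ X₂ X₃ X₄ L : V3)
  (X₁X₂X₃ : ¬ Collinear p X₁ X₂ X₃) (X₁X₂X₄ : ¬ Collinear p X₁ X₂ X₄)
  (X₁X₃X₄ : ¬ Collinear p X₁ X₃ X₄) (X₂X₃X₄ : ¬ Collinear p X₂ X₃ X₄)
  (X₁∉L : ¬ On p X₁ L) (X₂∉L : ¬ On p X₂ L) where

  open Modulo p p-prime

  Δ≢0 : ¬ Null (det X₁ X₂ X₃)
  Δ≢0 h = X₁X₂X₃ (null⇒zero h)

  open Frame X₁ X₂ X₃ Δ≢0

  s l : V3
  s = point X₄
  l = line L

  s₁≢0 : ¬ Null (x s)
  s₁≢0 h = X₂X₃X₄ (null⇒zero (null-≡ (sym (det-cyclic X₄ X₂ X₃)) h))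

  s₂≢0 : ¬ Null (y s)
  s₂≢0 h = X₁X₃X₄ (null⇒zero (null-neg (null-≡ (sym (trans (det-cyclic X₄ X₃ X₁) (det-swap X₃ X₁ X₄))) h)))

  s₃≢0 : ¬ Null (z s)
  s₃≢0 h = X₁X₂X₄ (null⇒zero (null-≡ (sym (det-cyclic X₄ X₁ X₂)) h))

  l₁≢0 : ¬ Null (x l)
  l₁≢0 h = X₁∉L (null⇒zero h)

  l₂≢0 : ¬ Null (y l)
  l₂≢0 h = X₂∉L (null⇒zero h)

  l≢0 : ¬ NullV l
  l≢0 (h , _ , _) = l₁≢0 h

  cremona-s≢0 : ¬ NullV (cremona s)
  cremona-s≢0 (h , _ , _) = ¬null-* s₂≢0 s₃≢0 h

  on-line : ∀ P → On p P L → Null (dot l (point P))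
  on-line P = incident P L

  E : V3 → V3 → ℤ
  E = sixPointForm s l

  point-X₅′ : ∀ P → point (X₅′ X₁ X₂ X₃ X₄ P L) ≡ fifth′ s l (point P)
  point-X₅′ P = begin
    point (cross (cross X₂ Y) L)      ≡⟨ frame-join X₁ X₂ X₃ (cross X₂ Y) L ⟩
    cross (line (cross X₂ Y)) l       ≡⟨ cong (λ M → cross M l) (dual-join₂ X₁ X₂ X₃ Y) ⟩
    cross (cross e₂ (point Y)) l
      ≡⟨ cong (λ y → cross (cross e₂ y) l) (frame-join X₁ X₂ X₃ (cross X₁ P) (cross X₃ X₄)) ⟩
    cross (cross e₂ (cross (line (cross X₁ P)) (line (cross X₃ X₄)))) l
      ≡⟨ cong₂ (λ m n → cross (cross e₂ (cross m n)) l) (dual-join₁ X₁ X₂ X₃ P) (dual-join₃ X₁ X₂ X₃ X₄) ⟩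
    fifth′ s l (point P)              ∎
    where
    open ≡-Reasoning
    Y = cross (cross X₁ P) (cross X₃ X₄)

  point-X₆′ : ∀ Q → point (X₆′ X₁ X₂ X₃ X₄ Q L) ≡ sixth′ s l (point Q)
  point-X₆′ Q = begin
    point (cross (cross X₁ Z) L)      ≡⟨ frame-join X₁ X₂ X₃ (cross X₁ Z) L ⟩
    cross (line (cross X₁ Z)) l       ≡⟨ cong (λ M → cross M l) (dual-join₁ X₁ X₂ X₃ Z) ⟩
    cross (cross e₁ (point Z)) l
      ≡⟨ cong (λ z → cross (cross e₁ z) l) (frame-join X₁ X₂ X₃ (cross X₂ Q) (cross X₃ X₄)) ⟩
    cross (cross e₁ (cross (line (cross X₂ Q)) (line (cross X₃ X₄)))) l
      ≡⟨ cong₂ (λ m n → cross (cross e₁ (cross m n)) l) (dual-join₂ X₁ X₂ X₃ Q) (dual-join₃ X₁ X₂ X₃ X₄) ⟩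
    sixth′ s l (point Q)              ∎
    where
    open ≡-Reasoning
    Z = cross (cross X₂ Q) (cross X₃ X₄)

  conic-of-sixPointForm : ∀ P Q → On p P L → On p Q L → Null (E (point P) (point Q)) →
    OnCommonConic6 p X₁ X₂ X₃ X₄ P Q
  conic-of-sixPointForm P Q P∈L Q∈L E≡0 = conic-from-normal (common-normal cremona-s≢0 D≡0)
    where
    t = point P
    u = point Q
    D≡0 : Null (det (cremona s) (cremona t) (cremona u))
    D≡0 = let w , w·l≢0 = nonzero-coordinate l≢0 in null-*-cancelˡ w·l≢0 (null-+-cancelʳ
      (null-≡ (cremona-det-via-sixPointForm s l t u w)
        (∣m∣n⇒∣m-n (∣m⇒∣m*n _ (on-line Q Q∈L)) (∣m⇒∣m*n _ (on-line P P∈L))))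
      (∣n⇒∣m*n (dot w (cross t u)) E≡0))
    conic-from-normal : CommonNormal (cremona s) (cremona t) (cremona u) → OnCommonConic6 p X₁ X₂ X₃ X₄ P Q
    conic-from-normal (β , β≢0 , βs , βt , βu) =
      conicThrough X₁ X₂ X₃ β , conicThrough-nonzero β β≢0 ,
      conicThrough-vertex₁ β , conicThrough-vertex₂ β , conicThrough-vertex₃ β ,
      conicThrough-on β X₄ βs , conicThrough-on β P βt , conicThrough-on β Q βu

  tangent-conic-of-sixPointForm : ∀ P Q → SamePt p P Q → ¬ NullV (point P) → ¬ NullV (point Q) → On p P L →
    Null (E (point P) (point Q)) → OnTangentConic5 p L X₁ X₂ X₃ X₄ P
  tangent-conic-of-sixPointForm P Q P≡Q t≢0 u≢0 P∈L Etu≡0 = conic-from-normal (common-normal cremona-s≢0 D≡0)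
    where
    t = point P
    u = point Q
    w = proj₁ (nonzero-coordinate t≢0)
    w·t≢0 = proj₂ (nonzero-coordinate t≢0)
    Ett≡0 : Null (E t t)
    Ett≡0 = let w′ , w′·u≢0 = nonzero-coordinate u≢0 in null-*-cancelʳ w′·u≢0
      (null-−-cancelˡ (sixPointForm-swap s l t u w′ (same⇒parallel P Q P≡Q)) (∣m⇒∣m*n _ Etu≡0))
    D≡0 : Null (det (cremona s) (cremona t) (cremonaPolar t (cross l w)))
    D≡0 = null-+-cancelʳ (null-≡ (cremonaPolar-det-via-sixPointForm s l t w) (∣m⇒∣m*n _ (on-line P P∈L)))
      (∣n⇒∣m*n (dot w t) Ett≡0)
    conic-from-normal : CommonNormal (cremona s) (cremona t) (cremonaPolar t (cross l w)) →
      OnTangentConic5 p L X₁ X₂ X₃ X₄ P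
    conic-from-normal (β , β≢0 , βs , βt , βtw) =
      conicThrough X₁ X₂ X₃ β , conicThrough-nonzero β β≢0 ,
      conicThrough-vertex₁ β , conicThrough-vertex₂ β , conicThrough-vertex₃ β ,
      conicThrough-on β X₄ βs , conicThrough-on β P βt ,
      λ W W∈L → null⇒zero (null-≡ (trans (conicThrough-polar X₁ X₂ X₃ β P W) (gradient-polar β t (point W)))
        (gradient-along-line β t l w l≢0 w·t≢0 βt βtw (on-line P P∈L) (on-line W W∈L)))

  sixPointForm-of-conic : ∀ P Q → ¬ SamePt p P Q → On p P L → On p Q L →
    OnCommonConic6 p X₁ X₂ X₃ X₄ P Q → Null (E (point P) (point Q))
  sixPointForm-of-conic P Q P≢Q P∈L Q∈L (q , q≢0 , o₁ , o₂ , o₃ , o₄ , o₅ , o₆) =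
    decidable-stable (+ p ∣? E t u) λ E≢0 → P≢Q (parallel⇒same P Q (nullV-from-dots λ w → null-*-cancelʳ E≢0
      (null-+-cancelˡ (null-≡ (cremona-det-via-sixPointForm s l t u w)
        (∣m∣n⇒∣m-n (∣m⇒∣m*n _ (on-line Q Q∈L)) (∣m⇒∣m*n _ (on-line P P∈L))))
        (∣n⇒∣m*n (dot w l) D≡0))))
    where
    open ThroughVertices q o₁ o₂ o₃
    t = point P
    u = point Q
    D≡0 : Null (det (cremona s) (cremona t) (cremona u))
    D≡0 = null-det-of-normal (β-nonzero q≢0) (on⇒null o₄) (on⇒null o₅) (on⇒null o₆)

  sixPointForm-of-tangent-conic : ∀ P Q → SamePt p P Q → ¬ NullV (point P) → On p P L →
    OnTangentConic5 p L X₁ X₂ X₃ X₄ P → Null (E (point P) (point Q))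
  sixPointForm-of-tangent-conic P Q P≡Q t≢0 P∈L (q , q≢0 , o₁ , o₂ , o₃ , o₄ , o₅ , tangent) =
    null-*-cancelʳ w·t≢0 (null-−-cancelʳ (sixPointForm-swap s l t u w (same⇒parallel P Q P≡Q)) (∣m⇒∣m*n _ Ett≡0))
    where
    open ThroughVertices q o₁ o₂ o₃
    t = point P
    u = point Q
    w = proj₁ (nonzero-coordinate t≢0)
    w·t≢0 = proj₂ (nonzero-coordinate t≢0)
    τ = cross l w
    W = combination X₁ X₂ X₃ τ
    W∈L : On p W L
    W∈L = null⇒zero (null-≡ (trans (combination-incidence X₁ X₂ X₃ τ L) (cross-orthogonalˡ l w)) null-0)
    rescale : dot β (cremonaPolar t (point W)) ≡ Δ * dot β (cremonaPolar t τ)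
    rescale = begin
      dot β (cremonaPolar t (point W))  ≡⟨ cong (λ v → dot β (cremonaPolar t v)) (frame-combination X₁ X₂ X₃ τ) ⟩
      dot β (cremonaPolar t (Δ *V τ))   ≡⟨ gradient-polar β t (Δ *V τ) ⟩
      dot (gradient β t) (Δ *V τ)       ≡⟨ dot-*V (gradient β t) Δ τ ⟩
      Δ * dot (gradient β t) τ          ≡⟨ cong (Δ *_) (sym (gradient-polar β t τ)) ⟩
      Δ * dot β (cremonaPolar t τ)      ∎
      where open ≡-Reasoning
    βτ : Null (dot β (cremonaPolar t τ))
    βτ = null-*-cancelˡ Δ≢0 (null-≡ (sym rescale) (polar⇒null (zero⇒null {polar q P W} (tangent W W∈L))))
    D≡0 : Null (det (cremona s) (cremona t) (cremonaPolar t τ))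
    D≡0 = null-det-of-normal (β-nonzero q≢0) (on⇒null o₄) (on⇒null o₅) βτ
    Ett≡0 : Null (E t t)
    Ett≡0 = null-*-cancelˡ w·t≢0 (null-+-cancelˡ
      (null-≡ (cremonaPolar-det-via-sixPointForm s l t w) (∣m⇒∣m*n _ (on-line P P∈L))) D≡0)

  X₅′∈L : ∀ P → On p (X₅′ X₁ X₂ X₃ X₄ P L) L
  X₅′∈L P = null⇒zero (null-≡ (cross-orthogonalʳ (cross X₂ (Y₁₂ X₁ X₃ X₄ P)) L) null-0)

  X₆′∈L : ∀ Q → On p (X₆′ X₁ X₂ X₃ X₄ Q L) L
  X₆′∈L Q = null⇒zero (null-≡ (cross-orthogonalʳ (cross X₁ (Z₁₂ X₂ X₃ X₄ Q)) L) null-0)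

  point-X₅′-nonzero : ∀ P → NonZeroV p P → On p P L → ¬ NullV (point (X₅′ X₁ X₂ X₃ X₄ P L))
  point-X₅′-nonzero P P≢0 P∈L X₅′≡0 = point-nonzero P P≢0 (t₁≡0 , t₂≡0 , t₃≡0)
    where
    t = point P
    t′≡0 : NullV (fifth′ s l t)
    t′≡0 = subst NullV (point-X₅′ P) X₅′≡0
    t₂≡0 = null-*-cancelˡ (¬null-* l₂≢0 s₁≢0) (null-neg (null-≡ (sym (fifth′-x s l t)) (proj₁ t′≡0)))
    t₃≡0 = null-*-cancelˡ (¬null-* l₂≢0 s₂≢0) (null-neg (null-≡ (sym (fifth′-z s l t)) (proj₂ (proj₂ t′≡0))))
    t₁≡0 = null-*-cancelˡ l₁≢0
      (null-+-cancelʳ (null-+-cancelʳ (on-line P P∈L) (∣n⇒∣m*n (z l) t₃≡0)) (∣n⇒∣m*n (y l) t₂≡0))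

  sixPointForm-B₁₂ : ∀ P Q → On p P L → On p Q L → ¬ Null (E (point P) (point Q)) →
    ¬ Null (E (point (X₅′ X₁ X₂ X₃ X₄ P L)) (point (X₆′ X₁ X₂ X₃ X₄ Q L)))
  sixPointForm-B₁₂ P Q P∈L Q∈L E≢0 E′≡0 =
    E≢0 (null-*-cancelˡ k≢0 (null-+-cancelˡ (null-≡ (sixPointForm-fifth′-sixth′ s l t u) R≡0) E″≡0))
    where
    t = point P
    u = point Q
    k≢0 : ¬ Null (x s * y s * x l * y l)
    k≢0 = ¬null-* (¬null-* (¬null-* s₁≢0 s₂≢0) l₁≢0) l₂≢0
    E″≡0 : Null (E (fifth′ s l t) (sixth′ s l u))
    E″≡0 = subst Null (cong₂ E (point-X₅′ P) (point-X₆′ Q)) E′≡0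
    R≡0 : Null (x l * y l * x s * y s * z s * (y s * x u * dot l t + x s * y t * dot l u))
    R≡0 = ∣n⇒∣m*n (x l * y l * x s * y s * z s)
      (∣m∣n⇒∣m+n (∣n⇒∣m*n (y s * x u) (on-line P P∈L)) (∣n⇒∣m*n (x s * y t) (on-line Q Q∈L)))

  noConic⇒sixPointForm≢0 : ∀ P Q → NonZeroV p P → NonZeroV p Q → On p P L → On p Q L →
    NoConic p X₁ X₂ X₃ X₄ P Q L → ¬ Null (E (point P) (point Q))
  noConic⇒sixPointForm≢0 P Q P≢0 Q≢0 P∈L Q∈L (no-sixPoint , no-tangent) E≡0 with nullV? (cross P Q)
  ... | yes P≡Q = no-tangent (nullV⇒zeroV P≡Q)
    (tangent-conic-of-sixPointForm P Q (nullV⇒zeroV P≡Q) (point-nonzero P P≢0) (point-nonzero Q Q≢0) P∈L E≡0)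
  ... | no P≢Q = no-sixPoint (λ P≡Q → P≢Q (zeroV⇒nullV P≡Q)) (conic-of-sixPointForm P Q P∈L Q∈L E≡0)

  sixPointForm≢0⇒noConic : ∀ P Q → ¬ NullV (point P) → On p P L → On p Q L →
    ¬ Null (E (point P) (point Q)) → NoConic p X₁ X₂ X₃ X₄ P Q L
  sixPointForm≢0⇒noConic P Q t≢0 P∈L Q∈L E≢0 =
    (λ P≢Q conic → E≢0 (sixPointForm-of-conic P Q P≢Q P∈L Q∈L conic)) ,
    (λ P≡Q conic → E≢0 (sixPointForm-of-tangent-conic P Q P≡Q t≢0 P∈L conic))

lemma4p1 : (p : ℕ) → Prime p → (X₁ X₂ X₃ X₄ X₅ X₆ L : V3)
    → NonZeroV p X₁ → NonZeroV p X₂ → NonZeroV p X₃ → NonZeroV p X₄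
    → NonZeroV p X₅ → NonZeroV p X₆ → NonZeroV p L
    → GeneralPosition4 p X₁ X₂ X₃ X₄
    → On p X₅ L → On p X₆ L
    → ¬ On p X₁ L → ¬ On p X₂ L → ¬ On p X₃ L → ¬ On p X₄ L
    → NoConic p X₁ X₂ X₃ X₄ X₅ X₆ L
    → NoConic p X₁ X₂ X₃ X₄ (X₅′ X₁ X₂ X₃ X₄ X₅ L) (X₆′ X₁ X₂ X₃ X₄ X₆ L) L
lemma4p1 p p-prime X₁ X₂ X₃ X₄ X₅ X₆ L _ _ _ _ X₅≢0 X₆≢0 _ (X₁X₂X₃ , X₁X₂X₄ , X₁X₃X₄ , X₂X₃X₄)
  X₅∈L X₆∈L X₁∉L X₂∉L _ _ old =
  sixPointForm≢0⇒noConic (X₅′ X₁ X₂ X₃ X₄ X₅ L) (X₆′ X₁ X₂ X₃ X₄ X₆ L)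
    (point-X₅′-nonzero X₅ X₅≢0 X₅∈L) (X₅′∈L X₅) (X₆′∈L X₆)
    (sixPointForm-B₁₂ X₅ X₆ X₅∈L X₆∈L (noConic⇒sixPointForm≢0 X₅ X₆ X₅≢0 X₆≢0 X₅∈L X₆∈L old))
  where open Configuration p p-prime X₁ X₂ X₃ X₄ L X₁X₂X₃ X₁X₂X₄ X₁X₃X₄ X₂X₃X₄ X₁∉L X₂∉L
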